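{- Over $\mathsf{DMA}$ the following operations are interdefinable (i.e. the clones generated by $\mathsf{DMA}$ together with any one of the operations in the same item coincide): (i) $x\rightarrow_{\mathrm{t\text-max}}y$ and $x\leftrightarrow_{\mathrm{i\text-min}}y$; (ii) $x\rightarrow_{\mathrm{i\text-max}}y$ and $x\leftrightarrow_{\mathrm{t\text-min}}y$; (iii) $x\leftrightarrow_{\mathsf t\mathsf f}y$, $x\rightarrow_{\mathrm G}y$ and $\Box x$; (iv) $x\rightarrow_{\mathsf t\mathsf f}y$ and $\Delta x$.
   Context: Let $\mathrm{DM}_4=\{\mathsf t,\mathsf f,\mathsf n,\mathsf b\}$. The truth order $\le$ has $\mathsf f$ least, $\mathsf t$ greatest, $\mathsf n,\mathsf b$ incomparable; $\wedge,\vee$ are its meet and join. De Morgan negation: $-\mathsf t=\mathsf f$, $-\mathsf f=\mathsf t$, $-\mathsf n=\mathsf n$, $-\mathsf b=\mathsf b$. A De Morgan function is a map $\mathrm{DM}_4^n\to\mathrm{DM}_4$, $n\ge1$; a clone is a set of such functions closed under composition and containing all projections; constants are unary constant functions. $\mathsf{DMA}$ is the clone generated by $\wedge,\vee,\mathsf t,\mathsf f,-$. Operations: $\Box a=\mathsf t$ if $a=\mathsf t$, else $\mathsf f$; $\Delta a=\mathsf t$ if $a\in\{\mathsf t,\mathsf b\}$, else $\mathsf f$; $a\rightarrow_{\mathrm{t\text-max}}b=\mathsf n$ if $a\in\{\mathsf t,\mathsf b\}$ and $b\in\{\mathsf f,\mathsf n\}$, else $\mathsf t$; $a\rightarrow_{\mathrm{i\text-max}}b=\mathsf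 f$ if $a\in\{\mathsf t,\mathsf b\}$ and $b\in\{\mathsf f,\mathsf n\}$, else $\mathsf b$; $a\rightarrow_{\mathsf t\mathsf f}b=\mathsf f$ if $a\in\{\mathsf t,\mathsf b\}$ and $b\in\{\mathsf f,\mathsf n\}$, else $\mathsf t$; $a\leftrightarrow_{\mathrm{t\text-min}}b=\mathsf b$ if $a=b$, else $\mathsf f$; $a\leftrightarrow_{\mathrm{i\text-min}}b=\mathsf t$ if $a=b$, else $\mathsf n$; $a\leftrightarrow_{\mathsf t\mathsf f}b=\mathsf t$ if $a=b$, else $\mathsf f$; $a\rightarrow_{\mathrm G}b=\mathsf t$ if $a\le b$ and $a\rightarrow_{\mathrm G}b=b$ otherwise. -}

module Defs where

open import Data.Nat using (ℕ; suc)
open import Data.Fin using (Fin; zero; suc)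
open import Data.Sum using (_⊎_; inj₁; inj₂)
open import Data.Unit using (⊤; tt)
open import Data.Product using (Σ; _×_)
open import Relation.Binary.PropositionalEquality using (_≡_)

data DM4 : Set where
  t f n b : DM4

-- Truth-order meet and join (f least, t greatest, n and b incomparable).
_∧_ : DM4 → DM4 → DM4
t ∧ y = y
f ∧ y = f
n ∧ t = n
n ∧ f = f
n ∧ n = n
n ∧ b = f
b ∧ t = b
b ∧ f = f
b ∧ n = f
b ∧ b = b

_∨_ : DM4 → DM4 → DM4
t ∨ y = t
f ∨ y = y
n ∨ t = t
n ∨ f = n
n ∨ n = n
n ∨ b = t
b ∨ t = t
b ∨ f = b
b ∨ n = t
b ∨ b = b

-_ : DM4 → DM4
- t = f
- f = t
- n = n
- b = b

_≤?_ : DM4 → DM4 → DM4 → DM4 → DM4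
-- (helper: if a ≤ c then x else y)
_≤?_ f c x y = x
_≤?_ t t x y = x
_≤?_ t _ x y = y
_≤?_ n t x y = x
_≤?_ n n x y = x
_≤?_ n _ x y = y
_≤?_ b t x y = x
_≤?_ b b x y = x
_≤?_ b _ x y = y

-- designated: a ∈ {t, b}
des : DM4 → DM4 → DM4 → DM4
des t x y = x
des b x y = x
des f x y = y
des n x y = y

eq? : DM4 → DM4 → DM4 → DM4 → DM4
eq? t t x y = x
eq? f f x y = x
eq? n n x y = x
eq? b b x y = x
eq? _ _ x y = y

□ : DM4 → DM4
□ t = t
□ _ = f

Δ : DM4 → DM4
Δ a = des a t f

-- "a ∈ {t,b} and c ∈ {f,n}" then x else y
impCase : DM4 → DM4 → DM4 → DM4 → DM4
impCase a c x y = des a (des c y x) y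

_→tmax_ : DM4 → DM4 → DM4
a →tmax c = impCase a c n t

_→imax_ : DM4 → DM4 → DM4
a →imax c = impCase a c f b

_→tf_ : DM4 → DM4 → DM4
a →tf c = impCase a c f t

_↔tmin_ : DM4 → DM4 → DM4
a ↔tmin c = eq? a c b f

_↔imin_ : DM4 → DM4 → DM4
a ↔imin c = eq? a c t n

_↔tf_ : DM4 → DM4 → DM4
a ↔tf c = eq? a c t f

_→G_ : DM4 → DM4 → DM4
a →G c = _≤?_ a c t c

record Signature : Set₁ where
  field
    Op    : Set
    arity : Op → ℕ
    ⟦_⟧   : (o : Op) → (Fin (arity o) → DM4) → DM4

open Signature public

data Term (S : Signature) (m : ℕ) : Set where
  var  : Fin m → Term S m
  node : (o : Op S) → (Fin (arity S o) → Term S m) → Term S m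

eval : ∀ {S m} → Term S m → (Fin m → DM4) → DM4
eval (var i) v = v i
eval {S} (node o ts) v = ⟦ S ⟧ o (λ j → eval (ts j) v)

InClone : (S : Signature) (m : ℕ) → ((Fin m → DM4) → DM4) → Set
InClone S m g = Σ (Term S m) (λ τ → ∀ v → eval τ v ≡ g v)

-- Two generating families generate the same clone (De Morgan functions
-- have arity ≥ 1).
SameClone : Signature → Signature → Set
SameClone S T = ∀ m (g : (Fin (suc m) → DM4) → DM4) →
  (InClone S (suc m) g → InClone T (suc m) g) ×
  (InClone T (suc m) g → InClone S (suc m) g)

-- Generators of DMA: ∧, ∨, the constants t and f (unary constant
-- functions), and negation.
data DMAOp : Set where
  opAnd opOr opT opF opNeg : DMAOp

dmaArity : DMAOp → ℕ
dmaArity opAnd = 2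
dmaArity opOr  = 2
dmaArity opT   = 1
dmaArity opF   = 1
dmaArity opNeg = 1

dmaSem : (o : DMAOp) → (Fin (dmaArity o) → DM4) → DM4
dmaSem opAnd v = v zero ∧ v (suc zero)
dmaSem opOr  v = v zero ∨ v (suc zero)
dmaSem opT   v = t
dmaSem opF   v = f
dmaSem opNeg v = - v zero

DMA+ : (k : ℕ) → ((Fin k → DM4) → DM4) → Signature
DMA+ k h = record
  { Op    = DMAOp ⊎ ⊤
  ; arity = λ { (inj₁ o) → dmaArity o ; (inj₂ _) → k }
  ; ⟦_⟧   = λ { (inj₁ o) → dmaSem o ; (inj₂ _) → h }
  }

DMA+₂ : (DM4 → DM4 → DM4) → Signature
DMA+₂ op = DMA+ 2 (λ v → op (v zero) (v (suc zero)))

DMA+₁ : (DM4 → DM4) → Signature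
DMA+₁ op = DMA+ 1 (λ v → op (v zero))

-- Each operation of an item is a DMA-term in every other one, and the finitely
-- many values of each such term are checked by evaluation.  Substituting these
-- terms for the generators translates terms of one signature into the other.
-- For (iii) it suffices to give ↔tf in □, □ in →G, →G in ↔tf and □ in ↔tf.
module Submission where

open import Defs
open import Data.Nat using (ℕ; suc)
open import Data.Fin using (Fin; zero; suc)
open import Data.Sum using (inj₁; inj₂)
open import Data.Unit using (tt)
open import Data.Product using (_×_; _,_; proj₁; proj₂)
open import Function using (_∘′_; _$_)
open import Data.Vec.Functional using (_∷_; [])
open import Relation.Nullary using (Dec; yes; no)
open import Relation.Nullary.Decidable using (True; toWitness; map′; _×-dec_)
open import Relation.Binary.PropositionalEquality
  using (_≡_; _≗_; refl; cong; cong₂; trans; module ≡-Reasoning)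

_≟_ : (x y : DM4) → Dec (x ≡ y)
t ≟ t = yes refl
t ≟ f = no λ ()
t ≟ n = no λ ()
t ≟ b = no λ ()
f ≟ t = no λ ()
f ≟ f = yes refl
f ≟ n = no λ ()
f ≟ b = no λ ()
n ≟ t = no λ ()
n ≟ f = no λ ()
n ≟ n = yes refl
n ≟ b = no λ ()
b ≟ t = no λ ()
b ≟ f = no λ ()
b ≟ n = no λ ()
b ≟ b = yes refl

∀-dec : {P : DM4 → Set} → (∀ x → Dec (P x)) → Dec (∀ x → P x)
∀-dec {P} P? = map′ all-four (λ h → h t , h f , h n , h b)
                    (P? t ×-dec P? f ×-dec P? n ×-dec P? b)
  where
  all-four : P t × P f × P n × P b → ∀ x → P x
  all-four (pt , pf , pn , pb) t = pt
  all-four (pt , pf , pn , pb) f = pf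
  all-four (pt , pf , pn , pb) n = pn
  all-four (pt , pf , pn , pb) b = pb

-- There is no function extensionality, so that operations respect pointwise
-- equality of their arguments has to be established separately.
OpExtensional : ∀ {k} → ((Fin k → DM4) → DM4) → Set
OpExtensional h = ∀ {v w} → v ≗ w → h v ≡ h w

Extensional : Signature → Set
Extensional S = ∀ o → OpExtensional (⟦ S ⟧ o)

eval-cong : ∀ {S m} → Extensional S → (τ : Term S m) →
            ∀ {v w} → v ≗ w → eval τ v ≡ eval τ w
eval-cong ext (var i)     v≗w = v≗w i
eval-cong ext (node o ts) v≗w = ext o (λ j → eval-cong ext (ts j) v≗w)

_[_] : ∀ {S k m} → Term S k → (Fin k → Term S m) → Term S m
var i     [ σ ] = σ i
node o ts [ σ ] = node o (λ j → ts j [ σ ])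

eval-[] : ∀ {S k m} → Extensional S → (τ : Term S k) (σ : Fin k → Term S m) →
          ∀ v → eval (τ [ σ ]) v ≡ eval τ (λ i → eval (σ i) v)
eval-[] ext (var i)     σ v = refl
eval-[] ext (node o ts) σ v = ext o (λ j → eval-[] ext (ts j) σ v)

_⊑_ : Signature → Signature → Set
S ⊑ T = ∀ m g → InClone S m g → InClone T m g

⊑-trans : ∀ {R S T} → R ⊑ S → S ⊑ T → R ⊑ T
⊑-trans R⊑S S⊑T m g = S⊑T m g ∘′ R⊑S m g

sameClone : ∀ {S T} → S ⊑ T → T ⊑ S → SameClone S T
sameClone S⊑T T⊑S m g = S⊑T (suc m) g , T⊑S (suc m) g

module _ {S T : Signature} (ext : Extensional T)
         (generators : ∀ o → InClone T (arity S o) (⟦ S ⟧ o)) where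

  translate : ∀ {m} → Term S m → Term T m
  translate (var i)     = var i
  translate (node o ts) = proj₁ (generators o) [ (λ i → translate (ts i)) ]

  eval-translate : ∀ {m} (τ : Term S m) v → eval (translate τ) v ≡ eval τ v
  eval-translate (var i)     v = refl
  eval-translate {m} (node o ts) v = begin
    eval (τₒ [ σ ]) v               ≡⟨ eval-[] ext τₒ σ v ⟩
    eval τₒ (λ i → eval (σ i) v)    ≡⟨ eval-cong ext τₒ (λ i → eval-translate (ts i) v) ⟩
    eval τₒ (λ i → eval (ts i) v)   ≡⟨ proj₂ (generators o) _ ⟩
    ⟦ S ⟧ o (λ i → eval (ts i) v)   ∎
    where
    open ≡-Reasoning
    τₒ : Term T (arity S o)
    τₒ = proj₁ (generators o)
    σ : Fin (arity S o) → Term T m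
    σ i = translate (ts i)

  ⊑-by-generators : S ⊑ T
  ⊑-by-generators m g (τ , τ≗g) = translate τ , λ v → trans (eval-translate τ v) (τ≗g v)

binary : (DM4 → DM4 → DM4) → (Fin 2 → DM4) → DM4
binary op v = op (v zero) (v (suc zero))

unary : (DM4 → DM4) → (Fin 1 → DM4) → DM4
unary op v = op (v zero)

binary-ext : ∀ op → OpExtensional (binary op)
binary-ext op v≗w = cong₂ op (v≗w zero) (v≗w (suc zero))

unary-ext : ∀ op → OpExtensional (unary op)
unary-ext op v≗w = cong op (v≗w zero)

module _ {k : ℕ} {h : (Fin k → DM4) → DM4} (h-ext : OpExtensional h) where

  DMA+-ext : Extensional (DMA+ k h)
  DMA+-ext (inj₁ opAnd) v≗w = cong₂ _∧_ (v≗w zero) (v≗w (suc zero))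
  DMA+-ext (inj₁ opOr)  v≗w = cong₂ _∨_ (v≗w zero) (v≗w (suc zero))
  DMA+-ext (inj₁ opT)   v≗w = refl
  DMA+-ext (inj₁ opF)   v≗w = refl
  DMA+-ext (inj₁ opNeg) v≗w = cong -_ (v≗w zero)
  DMA+-ext (inj₂ _)     v≗w = h-ext v≗w

  DMA+-⊑ : ∀ {j} {g : (Fin j → DM4) → DM4} → InClone (DMA+ k h) j g → DMA+ j g ⊑ DMA+ k h
  DMA+-⊑ {j} {g} g-definable = ⊑-by-generators DMA+-ext generators
    where
    generators : ∀ o → InClone (DMA+ k h) (arity (DMA+ j g) o) (⟦ DMA+ j g ⟧ o)
    generators (inj₁ o) = node (inj₁ o) var , λ v → refl
    generators (inj₂ _) = g-definable

  ⊑-by-term₂ : ∀ op (τ : Term (DMA+ k h) 2) →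
               {True (∀-dec λ x → ∀-dec λ y → eval τ (x ∷ y ∷ []) ≟ op x y)} →
               DMA+₂ op ⊑ DMA+ k h
  ⊑-by-term₂ op τ {checked} = DMA+-⊑ $ τ , λ v →
    trans (eval-cong DMA+-ext τ (split v)) (toWitness checked (v zero) (v (suc zero)))
    where
    split : (v : Fin 2 → DM4) → v ≗ (v zero ∷ v (suc zero) ∷ [])
    split v zero       = refl
    split v (suc zero) = refl

  ⊑-by-term₁ : ∀ op (τ : Term (DMA+ k h) 1) →
               {True (∀-dec λ x → eval τ (x ∷ []) ≟ op x)} →
               DMA+₁ op ⊑ DMA+ k h
  ⊑-by-term₁ op τ {checked} = DMA+-⊑ $ τ , λ v →
    trans (eval-cong DMA+-ext τ (split v)) (toWitness checked (v zero))
    where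
    split : (v : Fin 1 → DM4) → v ≗ (v zero ∷ [])
    split v zero = refl

module _ {k : ℕ} {h : (Fin k → DM4) → DM4} {m : ℕ} where

  infixr 6 _⋁_
  infixr 7 _⋀_
  infix  9 ∼_

  _⋀_ _⋁_ : Term (DMA+ k h) m → Term (DMA+ k h) m → Term (DMA+ k h) m
  a ⋀ c = node (inj₁ opAnd) (a ∷ c ∷ [])
  a ⋁ c = node (inj₁ opOr)  (a ∷ c ∷ [])

  ∼_ : Term (DMA+ k h) m → Term (DMA+ k h) m
  ∼ a = node (inj₁ opNeg) (a ∷ [])

  -- The constants of DMA are unary, so they need a variable to be applied to.
  𝐓 𝐅 : Term (DMA+ k h) (suc m)
  𝐓 = node (inj₁ opT) (var zero ∷ [])
  𝐅 = node (inj₁ opF) (var zero ∷ [])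

infix 8 _⊙_
infix 9 ◇_

_⊙_ : ∀ {h m} → Term (DMA+ 2 h) m → Term (DMA+ 2 h) m → Term (DMA+ 2 h) m
a ⊙ c = node (inj₂ tt) (a ∷ c ∷ [])

◇_ : ∀ {h m} → Term (DMA+ 1 h) m → Term (DMA+ 1 h) m
◇ a = node (inj₂ tt) (a ∷ [])

X : ∀ {k h m} → Term (DMA+ k h) (suc m)
X = var zero

Y : ∀ {k h m} → Term (DMA+ k h) (suc (suc m))
Y = var (suc zero)

-- A value x is determined by which of x, -x are designated, so for x ≠ y one of the
-- four implications has a designated antecedent and an undesignated consequent.
biimplication : ∀ {h m} → Term (DMA+ 2 h) m → Term (DMA+ 2 h) m → Term (DMA+ 2 h) m
biimplication a c = (a ⊙ c ⋀ c ⊙ a) ⋀ (∼ a ⊙ ∼ c ⋀ ∼ c ⊙ ∼ a)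

↔imin⊑→tmax : DMA+₂ _↔imin_ ⊑ DMA+₂ _→tmax_
↔imin⊑→tmax = ⊑-by-term₂ (binary-ext _→tmax_) _↔imin_ (biimplication X Y)

→tmax⊑↔imin : DMA+₂ _→tmax_ ⊑ DMA+₂ _↔imin_
→tmax⊑↔imin = ⊑-by-term₂ (binary-ext _↔imin_) _→tmax_ (Y ⋁ ∼ X ⊙ (X ⊙ 𝐅))

↔tmin⊑→imax : DMA+₂ _↔tmin_ ⊑ DMA+₂ _→imax_
↔tmin⊑→imax = ⊑-by-term₂ (binary-ext _→imax_) _↔tmin_ (biimplication X Y)

-- x ↔tmin x is the constant b, and z ∧ b is b or f as z is designated or not.
→imax⊑↔tmin : DMA+₂ _→imax_ ⊑ DMA+₂ _↔tmin_
→imax⊑↔tmin = ⊑-by-term₂ (binary-ext _↔tmin_) _→imax_ ((X ⋀ X ⊙ X) ⊙ (X ⊙ X ⋀ X ⋀ Y))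

□⊑↔tf : DMA+₁ □ ⊑ DMA+₂ _↔tf_
□⊑↔tf = ⊑-by-term₁ (binary-ext _↔tf_) □ (X ⊙ 𝐓)

-- □ x, □ -x tell x apart except when x ∈ {n, b}; there x = y iff x ∧ y ≠ f.
↔tf⊑□ : DMA+₂ _↔tf_ ⊑ DMA+₁ □
↔tf⊑□ = ⊑-by-term₂ (unary-ext □) _↔tf_
  ((◇ X ⋀ ◇ Y) ⋁ (◇ ∼ X ⋀ ◇ ∼ Y) ⋁
   (∼ ◇ X ⋀ ∼ ◇ ∼ X ⋀ ∼ ◇ Y ⋀ ∼ ◇ ∼ Y ⋀ ∼ ◇ ∼ (X ⋀ Y)))

→G⊑↔tf : DMA+₂ _→G_ ⊑ DMA+₂ _↔tf_
→G⊑↔tf = ⊑-by-term₂ (binary-ext _↔tf_) _→G_ (Y ⋁ X ⊙ (X ⋀ Y))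

□⊑→G : DMA+₁ □ ⊑ DMA+₂ _→G_
□⊑→G = ⊑-by-term₁ (binary-ext _→G_) □ (∼ X ⊙ 𝐅)

Δ⊑→tf : DMA+₁ Δ ⊑ DMA+₂ _→tf_
Δ⊑→tf = ⊑-by-term₁ (binary-ext _→tf_) Δ (𝐓 ⊙ X)

→tf⊑Δ : DMA+₂ _→tf_ ⊑ DMA+₁ Δ
→tf⊑Δ = ⊑-by-term₂ (unary-ext Δ) _→tf_ (◇ Y ⋁ ∼ ◇ X)

mainTheorem13 : SameClone (DMA+₂ _→tmax_) (DMA+₂ _↔imin_) ×
    SameClone (DMA+₂ _→imax_) (DMA+₂ _↔tmin_) ×
    (SameClone (DMA+₂ _↔tf_) (DMA+₂ _→G_) ×
    SameClone (DMA+₂ _↔tf_) (DMA+₁ □) ×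
    SameClone (DMA+₂ _→G_) (DMA+₁ □)) ×
    SameClone (DMA+₂ _→tf_) (DMA+₁ Δ)
mainTheorem13 =
  sameClone →tmax⊑↔imin ↔imin⊑→tmax ,
  sameClone →imax⊑↔tmin ↔tmin⊑→imax ,
  (sameClone (⊑-trans ↔tf⊑□ □⊑→G) →G⊑↔tf ,
   sameClone ↔tf⊑□ □⊑↔tf ,
   sameClone (⊑-trans →G⊑↔tf ↔tf⊑□) □⊑→G) ,
  sameClone →tf⊑Δ Δ⊑→tf
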